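{- Let $G_1$ and $G_2$ be connected graphs with disjoint vertex sets, $u_1\in V(G_1)$, $u_2\in V(G_2)$, with $|V(G_i)|=n_i\ge 2$ and $|E(G_i)|=m_i\ge 1$ for $i=1,2$. Let $G$ be the graph obtained by identifying $u_1$ and $u_2$ into a new vertex $u$. Then \[ W_e(G) = W_e(G_1) + W_e(G_2) + m_1\sum_{f \in E(G_2)}d_{G}(f,u) + m_2\sum_{g \in E(G_1)}d_{G}(g,u) + m_1m_2. \]
   Context: For a connected graph $G$ and edges $f=u_1u_2$, $g=v_1v_2$, $d_G(f,g)=\min\{d_G(u_i,v_j): i,j\in\{1,2\}\}+1$ if $f\neq g$, and $d_G(f,f)=0$; $W_e(G)=\sum_{\{f,g\}\subseteq E(G)} d_G(f,g)$ over unordered pairs of edges. For an edge $f=xy$ and a vertex $w$, $d_G(f,w)=\min\{d_G(x,w),d_G(y,w)\}$. -}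

module Defs where

open import Data.Nat using (ℕ; zero; suc; _+_; _⊔_; _⊓_)
open import Data.Bool using (Bool; true; false; _∧_; _∨_; if_then_else_)
open import Data.Fin using (Fin; _↑ˡ_; _↑ʳ_; splitAt; punchIn; punchOut; _≟_; _<?_)
open import Data.List using (List; []; _∷_; [_]; _++_; map; concatMap; length; allFin)
open import Data.Nat.ListAction using (sum)
open import Data.Bool.ListAction using (any)
open import Data.Maybe using (Maybe; just; nothing)
open import Data.Product using (_×_; _,_; ∃)
open import Data.Sum using (inj₁; inj₂)
open import Relation.Nullary using (yes; no)
open import Relation.Nullary.Decidable using (⌊_⌋)
open import Relation.Binary.PropositionalEquality using (_≡_)

Graph : ℕ → Set
Graph n = Fin n → Fin n → Bool

IsSimple : ∀ {n} → Graph n → Set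
IsSimple {n} G = (∀ (i j : Fin n) → G i j ≡ G j i) × (∀ (i : Fin n) → G i i ≡ false)

reach : ∀ {n} → Graph n → ℕ → Fin n → Fin n → Bool
reach G zero    x y = ⌊ x ≟ y ⌋
reach {n} G (suc k) x y = reach G k x y ∨ any (λ z → G x z ∧ reach G k z y) (allFin n)

Connected : ∀ {n} → Graph n → Set
Connected {n} G = ∀ (x y : Fin n) → ∃ λ k → reach G k x y ≡ true

-- least k in [start, start + fuel) satisfying p (or start + fuel if none)
firstTrue : (ℕ → Bool) → ℕ → ℕ → ℕ
firstTrue p k zero       = k
firstTrue p k (suc fuel) = if p k then k else firstTrue p (suc k) fuel

-- shortest-path distance d_G(x,y) (correct for connected graphs: it is < n)
dist : ∀ {n} → Graph n → Fin n → Fin n → ℕ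
dist {n} G x y = firstTrue (λ k → reach G k x y) 0 n

-- edges as pairs (i , j) with i < j and i ~ j
Edge : ℕ → Set
Edge n = Fin n × Fin n

edges : ∀ {n} → Graph n → List (Edge n)
edges {n} G = concatMap (λ i → concatMap (λ j →
  if ⌊ i <? j ⌋ ∧ G i j then [ (i , j) ] else []) (allFin n)) (allFin n)

numEdges : ∀ {n} → Graph n → ℕ
numEdges G = length (edges G)

sameEdge : ∀ {n} → Edge n → Edge n → Bool
sameEdge (a , b) (c , d) = ⌊ a ≟ c ⌋ ∧ ⌊ b ≟ d ⌋

min4 : ℕ → ℕ → ℕ → ℕ → ℕ
min4 a b c d = (a ⊓ b) ⊓ (c ⊓ d)

edgeDist : ∀ {n} → Graph n → Edge n → Edge n → ℕ
edgeDist G (u1 , u2) (v1 , v2) =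
  if sameEdge (u1 , u2) (v1 , v2) then 0
  else suc (min4 (dist G u1 v1) (dist G u1 v2) (dist G u2 v1) (dist G u2 v2))

edgeVertexDist : ∀ {n} → Graph n → Edge n → Fin n → ℕ
edgeVertexDist G (x , y) w = dist G x w ⊓ dist G y w

pairs : ∀ {A : Set} → List A → List (A × A)
pairs []       = []
pairs (x ∷ xs) = map (x ,_) xs ++ pairs xs

We : ∀ {n} → Graph n → ℕ
We G = sum (map (λ p → edgeDist G (Data.Product.proj₁ p) (Data.Product.proj₂ p)) (pairs (edges G)))

-- Coalescence: G1 on Fin n1, G2 on Fin (suc k2); identify u1 with u2.
-- The new graph has vertex set Fin (n1 + k2): left part = V(G1)
-- (u1 becomes the new vertex u), right part = V(G2) \ {u2}
-- (via punchIn u2).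

πL : ∀ {n1 k2} → Fin (n1 + k2) → Maybe (Fin n1)
πL {n1} v with splitAt n1 v
... | inj₁ a = just a
... | inj₂ _ = nothing

πR : ∀ {n1 k2} → Fin n1 → Fin (suc k2) → Fin (n1 + k2) → Maybe (Fin (suc k2))
πR {n1} u1 u2 v with splitAt n1 v
... | inj₁ a = if ⌊ a ≟ u1 ⌋ then just u2 else nothing
... | inj₂ b = just (punchIn u2 b)

liftAdj : ∀ {m} → Graph m → Maybe (Fin m) → Maybe (Fin m) → Bool
liftAdj G (just a) (just b) = G a b
liftAdj G _        _        = false

coalesce : ∀ {n1 k2} → Graph n1 → Graph (suc k2) → Fin n1 → Fin (suc k2) → Graph (n1 + k2)
coalesce {n1} {k2} G1 G2 u1 u2 x y =
  liftAdj G1 (πL {n1} {k2} x) (πL {n1} {k2} y) ∨ liftAdj G2 (πR u1 u2 x) (πR u1 u2 y)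

newVertex : ∀ {n1} k2 → Fin n1 → Fin (n1 + k2)
newVertex k2 u1 = u1 ↑ˡ k2

ι1 : ∀ {n1} k2 → Fin n1 → Fin (n1 + k2)
ι1 k2 a = a ↑ˡ k2

ι2 : ∀ {n1 k2} → Fin n1 → Fin (suc k2) → Fin (suc k2) → Fin (n1 + k2)
ι2 {n1} {k2} u1 u2 v with u2 ≟ v
... | yes _ = u1 ↑ˡ k2
... | no ne = n1 ↑ʳ punchOut ne

mapEdge : ∀ {m n} → (Fin m → Fin n) → Edge m → Edge n
mapEdge h (a , b) = h a , h b

-- The edge set of the coalescence G is the disjoint union of the (re-indexed) edge sets
-- of G₁ and G₂. Distances inside each part are those of the part: the embeddings do not
-- increase them, and G maps into the Cartesian product G₁ □ G₂ by the retractions that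
-- collapse the other part onto u, which does not increase them either. A walk from the
-- G₁ side to the G₂ side passes through u, so for f ∈ E(G₁), g ∈ E(G₂) the four endpoint
-- distances split as d(x, u) + d(y, u) and d(f, g) = d(f, u) + d(g, u) + 1. Splitting the
-- sum over pairs of edges of G into pairs inside E(G₁), inside E(G₂) and across, and
-- summing the last formula over E(G₁) × E(G₂), gives the identity.

module Submission where

open import Defs
open import Algebra.Properties.CommutativeSemigroup using (interchange)
open import Data.Bool using (Bool; true; false; T; if_then_else_; _∧_; _∨_)
open import Data.Bool.Properties using (T-∧; T-∨; T-≡)
open import Data.Empty using (⊥; ⊥-elim)
open import Data.Fin as Fin using (Fin; _≟_; _↑ʳ_; splitAt; punchIn; punchOut)
  renaming (_<_ to _<ᶠ_; _<?_ to _<ᶠ?_)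
import Data.Fin.Properties as Fin
open import Data.List using (List; []; _∷_; [_]; _++_; map; length; concatMap; allFin)
open import Data.List.Properties using (map-++; map-∘; map-cong-local)
open import Data.List.Membership.Propositional using (_∈_; lose)
open import Data.List.Membership.Propositional.Properties
  using (∈-concatMap⁺; ∈-concatMap⁻; ∈-allFin; ∈-++⁺ˡ; ∈-++⁺ʳ; ∈-++⁻; ∈-map⁺; ∈-map⁻)
open import Data.List.Membership.Propositional.Properties.WithK using (unique∧set⇒bag)
open import Data.List.Relation.Binary.BagAndSetEquality using (∼bag⇒↭)
open import Data.List.Relation.Binary.Permutation.Propositional as ↭ using (_↭_)
import Data.List.Relation.Binary.Permutation.Propositional.Properties as ↭
open import Data.List.Relation.Unary.All as All using (All; []; _∷_)
import Data.List.Relation.Unary.All.Properties as All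
open import Data.List.Relation.Unary.AllPairs as AllPairs using ([]; _∷_)
import Data.List.Relation.Unary.AllPairs.Properties as AllPairs
open import Data.List.Relation.Unary.Any using (here; satisfied)
open import Data.List.Relation.Unary.Any.Properties using (singleton⁻; any⁺; any⁻)
open import Data.List.Relation.Unary.Unique.Propositional using (Unique)
import Data.List.Relation.Unary.Unique.Propositional.Properties as Unique
open import Data.Maybe using (just; nothing; fromMaybe)
import Data.Nat as ℕ
open import Data.Nat using (ℕ; zero; suc; _+_; _*_; _≤_; _<_; z≤n; s≤s; _⊓_)
open import Data.Nat.ListAction using (sum)
open import Data.Nat.ListAction.Properties using (sum-++; sum-↭)
open import Data.Nat.Properties hiding (_≟_)
open import Data.Nat.Solver using (module +-*-Solver)
open import Data.Product using (Σ; _×_; _,_; proj₁; proj₂; swap)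
open import Data.Sum using (_⊎_; inj₁; inj₂)
open import Function using (_∘_; Equivalence; mk⇔)
open import Relation.Binary.Definitions using (tri<; tri≈; tri>)
open import Relation.Binary.PropositionalEquality hiding ([_])
open import Relation.Nullary using (yes; no)
open import Relation.Nullary.Decidable using (⌊_⌋; toWitness; fromWitness)

private
  variable
    A B : Set
    m n : ℕ

-- Sums over lists and over unordered pairs

sum-map-++ : (f : A → ℕ) (xs ys : List A) →
             sum (map f (xs ++ ys)) ≡ sum (map f xs) + sum (map f ys)
sum-map-++ f xs ys = trans (cong sum (map-++ f xs ys)) (sum-++ (map f xs) (map f ys))

sum-map-↭ : (f : A → ℕ) {xs ys : List A} → xs ↭ ys → sum (map f xs) ≡ sum (map f ys)
sum-map-↭ f p = sum-↭ (↭.map⁺ f p)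

sum-map-∘ : (f : B → ℕ) (h : A → B) (xs : List A) →
            sum (map f (map h xs)) ≡ sum (map (f ∘ h) xs)
sum-map-∘ f h xs = cong sum (sym (map-∘ xs))

sum-map-cong : {f g : A → ℕ} {xs : List A} → All (λ x → f x ≡ g x) xs →
               sum (map f xs) ≡ sum (map g xs)
sum-map-cong eqs = cong sum (map-cong-local eqs)

sum-map-const-+ : (c : ℕ) (f : A → ℕ) (xs : List A) →
                  sum (map (λ x → c + f x) xs) ≡ length xs * c + sum (map f xs)
sum-map-const-+ c f []       = refl
sum-map-const-+ c f (x ∷ xs) = begin
  c + f x + sum (map (λ x → c + f x) xs)
    ≡⟨ cong (c + f x +_) (sum-map-const-+ c f xs) ⟩
  c + f x + (length xs * c + sum (map f xs))
    ≡⟨ solve 4 (λ c y l s → c :+ y :+ (l :* c :+ s) := (c :+ l :* c) :+ (y :+ s))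
               refl c (f x) (length xs) (sum (map f xs)) ⟩
  (c + length xs * c) + (f x + sum (map f xs)) ∎
  where open ≡-Reasoning; open +-*-Solver

sum-map-suc : (f : A → ℕ) (xs : List A) → sum (map (suc ∘ f) xs) ≡ length xs + sum (map f xs)
sum-map-suc f xs = trans (sum-map-const-+ 1 f xs) (cong (_+ sum (map f xs)) (*-identityʳ (length xs)))

sum-map-sum-map-+ : (f : A → ℕ) (g : B → ℕ) (xs : List A) (ys : List B) →
  sum (map (λ x → sum (map (λ y → f x + g y) ys)) xs)
    ≡ length ys * sum (map f xs) + length xs * sum (map g ys)
sum-map-sum-map-+ f g []       ys = sym (cong (_+ 0) (*-zeroʳ (length ys)))
sum-map-sum-map-+ f g (x ∷ xs) ys = begin
  sum (map (λ y → f x + g y) ys) + sum (map (λ x → sum (map (λ y → f x + g y) ys)) xs)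
    ≡⟨ cong₂ _+_ (sum-map-const-+ (f x) g ys) (sum-map-sum-map-+ f g xs ys) ⟩
  (length ys * f x + G) + (length ys * F + length xs * G)
    ≡⟨ solve 5 (λ l y m s t → (l :* y :+ t) :+ (l :* s :+ m :* t) := l :* (y :+ s) :+ (t :+ m :* t))
               refl (length ys) (f x) (length xs) F G ⟩
  length ys * (f x + F) + (G + length xs * G) ∎
  where
  open ≡-Reasoning; open +-*-Solver
  F G : ℕ
  F = sum (map f xs)
  G = sum (map g ys)

pairSum : (A → A → ℕ) → List A → ℕ
pairSum f xs = sum (map (λ p → f (proj₁ p) (proj₂ p)) (pairs xs))

pairSum-∷ : (f : A → A → ℕ) (x : A) (xs : List A) →
            pairSum f (x ∷ xs) ≡ sum (map (f x) xs) + pairSum f xs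
pairSum-∷ f x xs = trans (sum-map-++ _ (map (x ,_) xs) (pairs xs))
                         (cong (_+ pairSum f xs) (sum-map-∘ _ (x ,_) xs))

pairSum-map : (f : B → B → ℕ) (h : A → B) (xs : List A) →
              pairSum f (map h xs) ≡ pairSum (λ x y → f (h x) (h y)) xs
pairSum-map f h []       = refl
pairSum-map f h (x ∷ xs) = begin
  pairSum f (h x ∷ map h xs)                                  ≡⟨ pairSum-∷ f (h x) (map h xs) ⟩
  sum (map (f (h x)) (map h xs)) + pairSum f (map h xs)       ≡⟨ cong₂ _+_ (sum-map-∘ (f (h x)) h xs) (pairSum-map f h xs) ⟩
  sum (map (f (h x) ∘ h) xs) + pairSum (λ x y → f (h x) (h y)) xs ≡⟨ pairSum-∷ _ x xs ⟨
  pairSum (λ x y → f (h x) (h y)) (x ∷ xs)                    ∎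
  where open ≡-Reasoning

pairSum-cong-All : {P : A → Set} {f g : A → A → ℕ} →
                   (∀ {x y} → P x → P y → f x y ≡ g x y) →
                   {xs : List A} → All P xs → pairSum f xs ≡ pairSum g xs
pairSum-cong-All f≗g []              = refl
pairSum-cong-All {f = f} {g} f≗g {x ∷ xs} (px ∷ pxs) = begin
  pairSum f (x ∷ xs)                  ≡⟨ pairSum-∷ f x xs ⟩
  sum (map (f x) xs) + pairSum f xs   ≡⟨ cong₂ _+_ (sum-map-cong (All.map (f≗g px) pxs)) (pairSum-cong-All f≗g pxs) ⟩
  sum (map (g x) xs) + pairSum g xs   ≡⟨ pairSum-∷ g x xs ⟨
  pairSum g (x ∷ xs)                  ∎
  where open ≡-Reasoning

pairSum-++ : (f : A → A → ℕ) (xs ys : List A) →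
  pairSum f (xs ++ ys) ≡ pairSum f xs + pairSum f ys + sum (map (λ x → sum (map (f x) ys)) xs)
pairSum-++ f []       ys = sym (+-identityʳ (pairSum f ys))
pairSum-++ f (x ∷ xs) ys = begin
  pairSum f (x ∷ xs ++ ys)
    ≡⟨ pairSum-∷ f x (xs ++ ys) ⟩
  sum (map (f x) (xs ++ ys)) + pairSum f (xs ++ ys)
    ≡⟨ cong₂ _+_ (sum-map-++ (f x) xs ys) (pairSum-++ f xs ys) ⟩
  (a + b) + (c + d + e)
    ≡⟨ solve 5 (λ a b c d e → (a :+ b) :+ (c :+ d :+ e) := (a :+ c) :+ d :+ (b :+ e)) refl a b c d e ⟩
  (a + c) + d + (b + e)
    ≡⟨ cong (λ s → s + d + (b + e)) (pairSum-∷ f x xs) ⟨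
  pairSum f (x ∷ xs) + pairSum f ys + sum (map (λ x → sum (map (f x) ys)) (x ∷ xs)) ∎
  where
  open ≡-Reasoning; open +-*-Solver
  a b c d e : ℕ
  a = sum (map (f x) xs)
  b = sum (map (f x) ys)
  c = pairSum f xs
  d = pairSum f ys
  e = sum (map (λ x → sum (map (f x) ys)) xs)

pairSum-↭ : (f : A → A → ℕ) → (∀ x y → f x y ≡ f y x) →
            {xs ys : List A} → xs ↭ ys → pairSum f xs ≡ pairSum f ys
pairSum-↭ f f-sym ↭.refl               = refl
pairSum-↭ f f-sym (↭.prep {xs} {ys} x p) = begin
  pairSum f (x ∷ xs)                  ≡⟨ pairSum-∷ f x xs ⟩
  sum (map (f x) xs) + pairSum f xs   ≡⟨ cong₂ _+_ (sum-map-↭ (f x) p) (pairSum-↭ f f-sym p) ⟩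
  sum (map (f x) ys) + pairSum f ys   ≡⟨ pairSum-∷ f x ys ⟨
  pairSum f (x ∷ ys)                  ∎
  where open ≡-Reasoning
pairSum-↭ f f-sym (↭.swap {xs} {ys} x y p) = begin
  pairSum f (x ∷ y ∷ xs)
    ≡⟨ trans (pairSum-∷ f x (y ∷ xs)) (cong₂ _+_ refl (pairSum-∷ f y xs)) ⟩
  (f x y + sum (map (f x) xs)) + (sum (map (f y) xs) + pairSum f xs)
    ≡⟨ cong₂ _+_ (cong₂ _+_ (f-sym x y) (sum-map-↭ (f x) p)) (cong₂ _+_ (sum-map-↭ (f y) p) (pairSum-↭ f f-sym p)) ⟩
  (f y x + a) + (b + c)
    ≡⟨ solve 4 (λ z a b c → (z :+ a) :+ (b :+ c) := (z :+ b) :+ (a :+ c)) refl (f y x) a b c ⟩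
  (f y x + b) + (a + c)
    ≡⟨ trans (pairSum-∷ f y (x ∷ ys)) (cong₂ _+_ refl (pairSum-∷ f x ys)) ⟨
  pairSum f (y ∷ x ∷ ys) ∎
  where
  open ≡-Reasoning; open +-*-Solver
  a b c : ℕ
  a = sum (map (f x) ys)
  b = sum (map (f y) ys)
  c = pairSum f ys
pairSum-↭ f f-sym (↭.trans p q)        = trans (pairSum-↭ f f-sym p) (pairSum-↭ f f-sym q)

unique-↭ : {xs ys : List A} → Unique xs → Unique ys →
           (∀ {z} → z ∈ xs → z ∈ ys) → (∀ {z} → z ∈ ys → z ∈ xs) → xs ↭ ys
unique-↭ xs! ys! to from = ∼bag⇒↭ (unique∧set⇒bag xs! ys! (mk⇔ to from))

Unique-map⁺-All : {P : A → Set} {f : A → B} →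
                  (∀ {x y} → P x → P y → f x ≡ f y → x ≡ y) →
                  {xs : List A} → All P xs → Unique xs → Unique (map f xs)
Unique-map⁺-All f-inj []         []           = []
Unique-map⁺-All f-inj (px ∷ pxs) (x∉xs ∷ xs!) =
  All.map⁺ (All.zipWith (λ (py , x≢y) fx≡fy → x≢y (f-inj px py fx≡fy)) (pxs , x∉xs))
  ∷ Unique-map⁺-All f-inj pxs xs!

Unique-concatMap⁺ : (f : A → List B) {xs : List A} → Unique xs → (∀ x → Unique (f x)) →
                    (∀ {x y z} → z ∈ f x → z ∈ f y → x ≡ y) → Unique (concatMap f xs)
Unique-concatMap⁺ f xs! f! f-disjoint =
  Unique.concat⁺ (All.map⁺ (All.tabulate (λ {x} _ → f! x)))
                 (AllPairs.map⁺ (AllPairs.map (λ x≢y {z} (z∈fx , z∈fy) → x≢y (f-disjoint z∈fx z∈fy)) xs!))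

-- The edge list of a graph

∈-if⁻ : ∀ (b : Bool) {y z : A} → z ∈ (if b then [ y ] else []) → T b × z ≡ y
∈-if⁻ true z∈ = _ , singleton⁻ z∈

∈-if⁺ : ∀ {b : Bool} {y : A} → T b → y ∈ (if b then [ y ] else [])
∈-if⁺ {b = true} _ = here refl

Unique-if : ∀ (b : Bool) {y : A} → Unique (if b then [ y ] else [])
Unique-if true  = [] ∷ []
Unique-if false = []

module _ {n} (G : Graph n) where

  private
    cell : Fin n → Fin n → List (Edge n)
    cell i j = if ⌊ i <ᶠ? j ⌋ ∧ G i j then [ (i , j) ] else []

    row : Fin n → List (Edge n)
    row i = concatMap (cell i) (allFin n)

    ∈-row⁻ : ∀ {i z} → z ∈ row i → Σ (Fin n) λ j → T (⌊ i <ᶠ? j ⌋ ∧ G i j) × z ≡ (i , j)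
    ∈-row⁻ {i} z∈ with satisfied (∈-concatMap⁻ (cell i) {allFin n} z∈)
    ... | j , z∈cell = j , ∈-if⁻ _ z∈cell

  ∈-edges⁻ : ∀ {i j} → (i , j) ∈ edges G → i <ᶠ j × T (G i j)
  ∈-edges⁻ e∈ with satisfied (∈-concatMap⁻ row {allFin n} e∈)
  ... | _ , e∈row with ∈-row⁻ e∈row
  ... | _ , t , refl = let i<j , Gij = Equivalence.to T-∧ t in toWitness i<j , Gij

  ∈-edges⁺ : ∀ {i j} → i <ᶠ j → T (G i j) → (i , j) ∈ edges G
  ∈-edges⁺ {i} {j} i<j Gij =
    ∈-concatMap⁺ row (lose (∈-allFin i)
      (∈-concatMap⁺ (cell i) (lose (∈-allFin j)
        (∈-if⁺ (Equivalence.from T-∧ (fromWitness i<j , Gij))))))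

  edges-unique : Unique (edges G)
  edges-unique = Unique-concatMap⁺ row (Unique.allFin⁺ n) row-unique rows-disjoint
    where
    row-unique : ∀ i → Unique (row i)
    row-unique i = Unique-concatMap⁺ (cell i) (Unique.allFin⁺ n) (λ _ → Unique-if _)
      (λ z∈ z∈′ → cong proj₂ (trans (sym (proj₂ (∈-if⁻ _ z∈))) (proj₂ (∈-if⁻ _ z∈′))))

    rows-disjoint : ∀ {i i′ z} → z ∈ row i → z ∈ row i′ → i ≡ i′
    rows-disjoint z∈ z∈′ with ∈-row⁻ z∈ | ∈-row⁻ z∈′
    ... | _ , _ , refl | _ , _ , refl = refl

Ordered : Edge n → Set
Ordered (a , b) = a <ᶠ b

edges-ordered : (G : Graph n) → All Ordered (edges G)
edges-ordered G = All.tabulate (λ e∈ → proj₁ (∈-edges⁻ G e∈))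

-- Walks and distance

infixr 5 _∷_
data Walk {n} (G : Graph n) : Fin n → Fin n → Set where
  []  : ∀ {x} → Walk G x x
  _∷_ : ∀ {x y z} → T (G x y) → Walk G y z → Walk G x z

module _ {n} {G : Graph n} where

  len : ∀ {x y} → Walk G x y → ℕ
  len []      = 0
  len (_ ∷ w) = suc (len w)

  infixr 5 _++ᵂ_
  _++ᵂ_ : ∀ {x y z} → Walk G x y → Walk G y z → Walk G x z
  []      ++ᵂ v = v
  (e ∷ w) ++ᵂ v = e ∷ (w ++ᵂ v)

  len-++ᵂ : ∀ {x y z} (w : Walk G x y) (v : Walk G y z) → len (w ++ᵂ v) ≡ len w + len v
  len-++ᵂ []      v = refl
  len-++ᵂ (e ∷ w) v = cong suc (len-++ᵂ w v)

  castᵂ : ∀ {x x′ y y′} → x ≡ x′ → y ≡ y′ → Walk G x y → Walk G x′ y′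
  castᵂ refl refl w = w

  len-castᵂ : ∀ {x x′ y y′} (p : x ≡ x′) (q : y ≡ y′) (w : Walk G x y) → len (castᵂ p q w) ≡ len w
  len-castᵂ refl refl w = refl

  vertexAt : ∀ {x y} (w : Walk G x y) → Fin (suc (len w)) → Fin n
  vertexAt {x} w       Fin.zero    = x
  vertexAt     (_ ∷ w) (Fin.suc i) = vertexAt w i

  dropᵂ : ∀ {x y} (w : Walk G x y) (i : Fin (suc (len w))) → Walk G (vertexAt w i) y
  dropᵂ w       Fin.zero    = w
  dropᵂ (_ ∷ w) (Fin.suc i) = dropᵂ w i

  len-dropᵂ : ∀ {x y} (w : Walk G x y) i → len (dropᵂ w i) ≤ len w
  len-dropᵂ w       Fin.zero    = ≤-refl
  len-dropᵂ (_ ∷ w) (Fin.suc i) = m≤n⇒m≤1+n (len-dropᵂ w i)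

  cutᵂ : ∀ {x y} (w : Walk G x y) (i j : Fin (suc (len w))) →
         i <ᶠ j → vertexAt w i ≡ vertexAt w j → Σ (Walk G x y) λ v → len v < len w
  cutᵂ (e ∷ w) Fin.zero    (Fin.suc j) _         refl = dropᵂ w j , s≤s (len-dropᵂ w j)
  cutᵂ (e ∷ w) (Fin.suc i) (Fin.suc j) (s≤s i<j) eq   =
    let v , v<w = cutᵂ w i j i<j eq in e ∷ v , s≤s v<w

  shortenᵂ : ∀ {x y} → Walk G x y → Σ (Walk G x y) λ v → len v < n
  shortenᵂ w = go (len w) w ≤-refl
    where
    go : ∀ {x y} k (w : Walk G x y) → len w ≤ k → Σ (Walk G x y) λ v → len v < n
    go k w w≤k with len w <? n
    ... | yes w<n = w , w<n
    ... | no  w≮n with Fin.pigeonhole (≰⇒> w≮n) (vertexAt w)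
    ... | i , j , i<j , eq with cutᵂ w i j i<j eq | k
    ...   | v , v<w | suc k = go k v (≤-pred (≤-trans v<w w≤k))
    ...   | v , v<w | zero  = ⊥-elim (<⇒≱ v<w (≤-trans w≤k z≤n))

  reach-refl : ∀ k x → T (reach G k x x)
  reach-refl zero    x = fromWitness refl
  reach-refl (suc k) x = Equivalence.from T-∨ (inj₁ (reach-refl k x))

  walk⇒reach : ∀ {k x y} (w : Walk G x y) → len w ≤ k → T (reach G k x y)
  walk⇒reach {k} {x} []                      _           = reach-refl k x
  walk⇒reach {suc k} (_∷_ {y = z} e w) (s≤s w≤k) =
    Equivalence.from T-∨ (inj₂ (any⁺ _ (lose (∈-allFin z)
      (Equivalence.from T-∧ (e , walk⇒reach w w≤k)))))

  reach⇒walk : ∀ k {x y} → T (reach G k x y) → Σ (Walk G x y) λ w → len w ≤ k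
  reach⇒walk zero    r with toWitness r
  ... | refl = [] , z≤n
  reach⇒walk (suc k) {x} {y} r with Equivalence.to T-∨ r
  ... | inj₁ r′ = let w , w≤k = reach⇒walk k r′ in w , m≤n⇒m≤1+n w≤k
  ... | inj₂ r′ with satisfied (any⁻ _ (allFin n) r′)
  ... | z , t = let e , r″ = Equivalence.to T-∧ t
                    w , w≤k = reach⇒walk k r″
                in e ∷ w , s≤s w≤k

connected-walk : {G : Graph n} → Connected G → ∀ x y → Walk G x y
connected-walk c x y = let k , r = c x y in proj₁ (reach⇒walk k (Equivalence.from T-≡ r))

firstTrue-≤ : ∀ (p : ℕ → Bool) s fuel {d} → T (p d) → s ≤ d → firstTrue p s fuel ≤ d
firstTrue-≤ p s zero       _   s≤d = s≤d
firstTrue-≤ p s (suc fuel) pd  s≤d with p s in ps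
... | true  = s≤d
... | false = firstTrue-≤ p (suc s) fuel pd (≤∧≢⇒< s≤d λ { refl → subst T ps pd })

firstTrue-sound : ∀ (p : ℕ → Bool) s fuel {d} → T (p d) → s ≤ d → d < s + fuel →
                  T (p (firstTrue p s fuel))
firstTrue-sound p s zero       _  s≤d d<s+0 = ⊥-elim (<⇒≱ d<s+0 (≤-trans (≤-reflexive (+-identityʳ s)) s≤d))
firstTrue-sound p s (suc fuel) pd s≤d d<s+fuel with p s in ps
... | true  = subst T (sym ps) _
... | false = firstTrue-sound p (suc s) fuel pd (≤∧≢⇒< s≤d λ { refl → subst T ps pd })
                                                 (subst (_<_ _) (+-suc s fuel) d<s+fuel)

firstTrue-cong : ∀ {p q : ℕ → Bool} → (∀ k → p k ≡ q k) → ∀ s fuel → firstTrue p s fuel ≡ firstTrue q s fuel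
firstTrue-cong p≗q s zero       = refl
firstTrue-cong p≗q s (suc fuel) rewrite p≗q s | firstTrue-cong p≗q (suc s) fuel = refl

module _ {n} {G : Graph n} where

  dist-≤ : ∀ {x y} (w : Walk G x y) → dist G x y ≤ len w
  dist-≤ {x} {y} w = firstTrue-≤ (λ k → reach G k x y) 0 n (walk⇒reach w ≤-refl) z≤n

  -- dist searches only the lengths below n, so pigeonhole shortening is needed here
  geodesic : ∀ {x y} → Walk G x y → Σ (Walk G x y) λ w → len w ≤ dist G x y
  geodesic w = let v , v<n = shortenᵂ w in
    reach⇒walk (dist G _ _) (firstTrue-sound (λ k → reach G k _ _) 0 n (walk⇒reach v ≤-refl) z≤n v<n)

T-injective : ∀ {a b} → (T a → T b) → (T b → T a) → a ≡ b
T-injective {true}  {true}  _ _ = refl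
T-injective {true}  {false} f _ = ⊥-elim (f _)
T-injective {false} {true}  _ g = ⊥-elim (g _)
T-injective {false} {false} _ _ = refl

module _ {n} {G : Graph n} (G-sym : ∀ x y → G x y ≡ G y x) where

  reverseᵂ : ∀ {x y} → Walk G x y → Walk G y x
  reverseᵂ []      = []
  reverseᵂ (e ∷ w) = reverseᵂ w ++ᵂ (subst T (G-sym _ _) e ∷ [])

  len-reverseᵂ : ∀ {x y} (w : Walk G x y) → len (reverseᵂ w) ≡ len w
  len-reverseᵂ []      = refl
  len-reverseᵂ (e ∷ w) = trans (len-++ᵂ (reverseᵂ w) _) (trans (+-comm _ 1) (cong suc (len-reverseᵂ w)))

  reach-sym : ∀ k x y → reach G k x y ≡ reach G k y x
  reach-sym k x y = T-injective (flip x y) (flip y x)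
    where
    flip : ∀ a b → T (reach G k a b) → T (reach G k b a)
    flip a b r = let w , w≤k = reach⇒walk k r in
      walk⇒reach (reverseᵂ w) (≤-trans (≤-reflexive (len-reverseᵂ w)) w≤k)

  dist-sym : ∀ x y → dist G x y ≡ dist G y x
  dist-sym x y = firstTrue-cong (λ k → reach-sym k x y) 0 n

module _ {m n} {G : Graph m} (H : Graph n) (φ : Fin m → Fin n)
         (φ-hom : ∀ {x y} → T (G x y) → T (H (φ x) (φ y))) where

  mapᵂ : ∀ {x y} → Walk G x y → Walk H (φ x) (φ y)
  mapᵂ []      = []
  mapᵂ (e ∷ w) = φ-hom e ∷ mapᵂ w

  len-mapᵂ : ∀ {x y} (w : Walk G x y) → len (mapᵂ w) ≡ len w
  len-mapᵂ []      = refl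
  len-mapᵂ (e ∷ w) = cong suc (len-mapᵂ w)

  dist-hom-≤ : ∀ {x y} → Walk G x y → dist H (φ x) (φ y) ≤ dist G x y
  dist-hom-≤ w = let v , v≤d = geodesic w in
    ≤-trans (dist-≤ (mapᵂ v)) (≤-trans (≤-reflexive (len-mapᵂ v)) v≤d)

-- (h₁ , h₂) maps G into the Cartesian product of H₁ and H₂, where distances add up.
module _ {m n₁ n₂} {G : Graph m} {H₁ : Graph n₁} {H₂ : Graph n₂}
         (h₁ : Fin m → Fin n₁) (h₂ : Fin m → Fin n₂)
         (h-step : ∀ {x y} → T (G x y) →
                   T (H₁ (h₁ x) (h₁ y)) × h₂ x ≡ h₂ y ⊎ h₁ x ≡ h₁ y × T (H₂ (h₂ x) (h₂ y))) where

  projectᵂ : ∀ {x y} (w : Walk G x y) →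
             Σ (Walk H₁ (h₁ x) (h₁ y)) λ v₁ → Σ (Walk H₂ (h₂ x) (h₂ y)) λ v₂ → len v₁ + len v₂ ≡ len w
  projectᵂ []      = [] , [] , refl
  projectᵂ (e ∷ w) with projectᵂ w | h-step e
  ... | v₁ , v₂ , eq | inj₁ (e₁ , h₂≡) =
    e₁ ∷ v₁ , castᵂ (sym h₂≡) refl v₂ , cong suc (trans (cong (len v₁ +_) (len-castᵂ (sym h₂≡) refl v₂)) eq)
  ... | v₁ , v₂ , eq | inj₂ (h₁≡ , e₂) =
    castᵂ (sym h₁≡) refl v₁ , e₂ ∷ v₂ ,
    trans (cong (_+ suc (len v₂)) (len-castᵂ (sym h₁≡) refl v₁)) (trans (+-suc (len v₁) (len v₂)) (cong suc eq))

  dist-product-≤ : ∀ {x y} → Walk G x y → dist H₁ (h₁ x) (h₁ y) + dist H₂ (h₂ x) (h₂ y) ≤ dist G x y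
  dist-product-≤ w = let v , v≤d = geodesic w
                         v₁ , v₂ , eq = projectᵂ v
                     in ≤-trans (+-mono-≤ (dist-≤ v₁) (dist-≤ v₂)) (≤-trans (≤-reflexive eq) v≤d)

-- Edge distance

min4-+ : ∀ a b c d → min4 (a + c) (a + d) (b + c) (b + d) ≡ (a ⊓ b) + (c ⊓ d)
min4-+ a b c d = sym (trans (+-distribʳ-⊓ (c ⊓ d) a b)
                            (cong₂ _⊓_ (+-distribˡ-⊓ a c d) (+-distribˡ-⊓ b c d)))

endpointDist : Graph n → Edge n → Edge n → ℕ
endpointDist G (a , b) (c , d) = min4 (dist G a c) (dist G a d) (dist G b c) (dist G b d)

sameEdge-sound : (e f : Edge n) → T (sameEdge e f) → e ≡ f
sameEdge-sound (a , b) (c , d) t with Equivalence.to (T-∧ {⌊ a ≟ c ⌋} {⌊ b ≟ d ⌋}) t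
... | a≡c , b≡d = cong₂ _,_ (toWitness a≡c) (toWitness b≡d)

sameEdge-refl : (e : Edge n) → T (sameEdge e e)
sameEdge-refl (a , b) = Equivalence.from (T-∧ {⌊ a ≟ a ⌋} {⌊ b ≟ b ⌋}) (fromWitness refl , fromWitness refl)

sameEdge-cong : (e f : Edge m) (e′ f′ : Edge n) → (e ≡ f → e′ ≡ f′) → (e′ ≡ f′ → e ≡ f) →
                sameEdge e f ≡ sameEdge e′ f′
sameEdge-cong e f e′ f′ to from = T-injective
  (λ t → subst (T ∘ sameEdge e′) (to (sameEdge-sound e f t)) (sameEdge-refl e′))
  (λ t → subst (T ∘ sameEdge e) (from (sameEdge-sound e′ f′ t)) (sameEdge-refl e))

sameEdge-≢ : (e f : Edge n) → e ≢ f → sameEdge e f ≡ false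
sameEdge-≢ e f e≢f with sameEdge e f in same
... | true  = ⊥-elim (e≢f (sameEdge-sound e f (subst T (sym same) _)))
... | false = refl

edgeDist-≢ : (G : Graph n) (e f : Edge n) → e ≢ f → edgeDist G e f ≡ suc (endpointDist G e f)
edgeDist-≢ G e f e≢f = cong (λ s → if s then 0 else suc (endpointDist G e f)) (sameEdge-≢ e f e≢f)

edgeDist-cong : (G : Graph m) (H : Graph n) (e f : Edge m) (e′ f′ : Edge n) →
                sameEdge e f ≡ sameEdge e′ f′ → endpointDist G e f ≡ endpointDist H e′ f′ →
                edgeDist G e f ≡ edgeDist H e′ f′
edgeDist-cong G H e f e′ f′ = cong₂ (λ s k → if s then 0 else suc k)

edgeDist-sym : {G : Graph n} → (∀ x y → G x y ≡ G y x) → ∀ e f → edgeDist G e f ≡ edgeDist G f e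
edgeDist-sym {G = G} G-sym e@(a , b) f@(c , d) = edgeDist-cong G G e f f e
  (sameEdge-cong e f f e sym sym)
  (trans (cong₂ _⊓_ (cong₂ _⊓_ (dist-sym G-sym a c) (dist-sym G-sym a d))
                    (cong₂ _⊓_ (dist-sym G-sym b c) (dist-sym G-sym b d)))
         (interchange ⊓-commutativeSemigroup (dist G c a) (dist G d a) (dist G c b) (dist G d b)))

edgeDist-map : {G : Graph m} {H : Graph n} (φ : Fin m → Fin n) → (∀ {a b} → φ a ≡ φ b → a ≡ b) →
               (∀ a b → dist H (φ a) (φ b) ≡ dist G a b) →
               ∀ e f → edgeDist H (mapEdge φ e) (mapEdge φ f) ≡ edgeDist G e f
edgeDist-map {G = G} {H} φ φ-inj φ-dist e@(a , b) f@(c , d) = edgeDist-cong H G (mapEdge φ e) (mapEdge φ f) e f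
  (sameEdge-cong (mapEdge φ e) (mapEdge φ f) e f
     (λ eq → cong₂ _,_ (φ-inj (cong proj₁ eq)) (φ-inj (cong proj₂ eq))) (cong (mapEdge φ)))
  (cong₂ _⊓_ (cong₂ _⊓_ (φ-dist a c) (φ-dist a d)) (cong₂ _⊓_ (φ-dist b c) (φ-dist b d)))

orient : Edge n → Edge n
orient (a , b) = if ⌊ a <ᶠ? b ⌋ then (a , b) else (b , a)

orient-cases : (e : Edge n) → orient e ≡ e ⊎ orient e ≡ swap e
orient-cases (a , b) with a <ᶠ? b
... | yes _ = inj₁ refl
... | no  _ = inj₂ refl

orient-< : {a b : Fin n} → a <ᶠ b → orient (a , b) ≡ (a , b)
orient-< {a = a} {b} a<b with a <ᶠ? b
... | yes _   = refl
... | no  a≮b = ⊥-elim (a≮b a<b)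

orient-> : {a b : Fin n} → b <ᶠ a → orient (a , b) ≡ (b , a)
orient-> {a = a} {b} b<a with a <ᶠ? b
... | yes a<b = ⊥-elim (Fin.<-asym a<b b<a)
... | no  _   = refl

orient-swap : {a b : Fin n} → a ≢ b → orient (b , a) ≡ orient (a , b)
orient-swap {a = a} {b} a≢b with Fin.<-cmp a b
... | tri< a<b _ _ = trans (orient-> a<b) (sym (orient-< a<b))
... | tri≈ _ a≡b _ = ⊥-elim (a≢b a≡b)
... | tri> _ _ b<a = trans (orient-< b<a) (sym (orient-> b<a))

orient-ordered : {a b : Fin n} → a ≢ b → proj₁ (orient (a , b)) <ᶠ proj₂ (orient (a , b))
orient-ordered {a = a} {b} a≢b with Fin.<-cmp a b
... | tri< a<b _ _ = subst (λ e → proj₁ e <ᶠ proj₂ e) (sym (orient-< a<b)) a<b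
... | tri≈ _ a≡b _ = ⊥-elim (a≢b a≡b)
... | tri> _ _ b<a = subst (λ e → proj₁ e <ᶠ proj₂ e) (sym (orient-> b<a)) b<a

orient-cancel : (e f : Edge n) → orient e ≡ orient f → e ≡ f ⊎ e ≡ swap f
orient-cancel e f eq with orient-cases e | orient-cases f
... | inj₁ e≡ | inj₁ f≡ = inj₁ (trans (sym e≡) (trans eq f≡))
... | inj₁ e≡ | inj₂ f≡ = inj₂ (trans (sym e≡) (trans eq f≡))
... | inj₂ e≡ | inj₁ f≡ = inj₂ (cong swap (trans (sym e≡) (trans eq f≡)))
... | inj₂ e≡ | inj₂ f≡ = inj₁ (cong swap (trans (sym e≡) (trans eq f≡)))

endpointDist-orientˡ : (G : Graph n) (e f : Edge n) → endpointDist G (orient e) f ≡ endpointDist G e f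
endpointDist-orientˡ G e f with orient-cases e
... | inj₁ e≡ = cong (λ e → endpointDist G e f) e≡
... | inj₂ e≡ = trans (cong (λ e → endpointDist G e f) e≡) (⊓-comm _ _)

endpointDist-orientʳ : (G : Graph n) (e f : Edge n) → endpointDist G e (orient f) ≡ endpointDist G e f
endpointDist-orientʳ G e f with orient-cases f
... | inj₁ f≡ = cong (endpointDist G e) f≡
... | inj₂ f≡ = trans (cong (endpointDist G e) f≡) (cong₂ _⊓_ (⊓-comm _ _) (⊓-comm _ _))

edgeDist-orient : (G : Graph n) (e f : Edge n) → (orient e ≡ orient f → e ≡ f) →
                  edgeDist G (orient e) (orient f) ≡ edgeDist G e f
edgeDist-orient G e f cancel = edgeDist-cong G G (orient e) (orient f) e f
        (sameEdge-cong (orient e) (orient f) e f cancel (cong orient))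
        (trans (endpointDist-orientˡ G e (orient f)) (endpointDist-orientʳ G e f))

-- The coalescence of G₁ and G₂ at u₁ ~ u₂

module Coalescence {n₁ k₂} (G₁ : Graph n₁) (G₂ : Graph (suc k₂)) (u₁ : Fin n₁) (u₂ : Fin (suc k₂)) where

  G : Graph (n₁ + k₂)
  G = coalesce G₁ G₂ u₁ u₂

  ι₁ : Fin n₁ → Fin (n₁ + k₂)
  ι₁ = ι1 k₂

  ι₂ : Fin (suc k₂) → Fin (n₁ + k₂)
  ι₂ = ι2 u₁ u₂

  u : Fin (n₁ + k₂)
  u = newVertex k₂ u₁

  ι₂-u₂ : ι₂ u₂ ≡ u
  ι₂-u₂ with u₂ ≟ u₂
  ... | yes _   = refl
  ... | no  u≢u = ⊥-elim (u≢u refl)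

  ι₂-punchIn : ∀ b → ι₂ (punchIn u₂ b) ≡ n₁ ↑ʳ b
  ι₂-punchIn b with u₂ ≟ punchIn u₂ b
  ... | yes u₂≡ = ⊥-elim (Fin.punchInᵢ≢i u₂ b (sym u₂≡))
  ... | no  _   = cong (n₁ ↑ʳ_) (trans (Fin.punchOut-cong u₂ refl) (Fin.punchOut-punchIn u₂))

  πL-ι₁ : ∀ a → πL {n₁} {k₂} (ι₁ a) ≡ just a
  πL-ι₁ a rewrite Fin.splitAt-↑ˡ n₁ a k₂ = refl

  πL-↑ʳ : ∀ b → πL {n₁} {k₂} (n₁ ↑ʳ b) ≡ nothing
  πL-↑ʳ b rewrite Fin.splitAt-↑ʳ n₁ k₂ b = refl

  πR-ι₁ : ∀ a → πR u₁ u₂ (ι₁ a) ≡ (if ⌊ a ≟ u₁ ⌋ then just u₂ else nothing)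
  πR-ι₁ a rewrite Fin.splitAt-↑ˡ n₁ a k₂ = refl

  πR-ι₂ : ∀ p → πR u₁ u₂ (ι₂ p) ≡ just p
  πR-ι₂ p with u₂ ≟ p
  ... | yes refl rewrite πR-ι₁ u₁ with u₁ ≟ u₁
  ...   | yes _   = refl
  ...   | no  u≢u = ⊥-elim (u≢u refl)
  πR-ι₂ p | no u₂≢p rewrite Fin.splitAt-↑ʳ n₁ k₂ (punchOut {i = u₂} u₂≢p) = cong just (Fin.punchIn-punchOut u₂≢p)

  πL-just : ∀ {v a} → πL {n₁} {k₂} v ≡ just a → ι₁ a ≡ v
  πL-just {v} eq with splitAt n₁ v in split
  πL-just refl | inj₁ _ = Fin.splitAt⁻¹-↑ˡ split

  πR-just : ∀ {v p} → πR u₁ u₂ v ≡ just p → ι₂ p ≡ v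
  πR-just {v} eq with splitAt n₁ v in split
  πR-just refl | inj₂ b = trans (ι₂-punchIn b) (Fin.splitAt⁻¹-↑ʳ split)
  πR-just eq   | inj₁ a with a ≟ u₁
  πR-just refl | inj₁ a | yes refl = trans ι₂-u₂ (Fin.splitAt⁻¹-↑ˡ split)

  -- retractions of V(G) onto V(G₁) and V(G₂), collapsing the other side to u
  ρ₁ : Fin (n₁ + k₂) → Fin n₁
  ρ₁ v = fromMaybe u₁ (πL {n₁} {k₂} v)

  ρ₂ : Fin (n₁ + k₂) → Fin (suc k₂)
  ρ₂ v = fromMaybe u₂ (πR u₁ u₂ v)

  ρ₁-ι₁ : ∀ a → ρ₁ (ι₁ a) ≡ a
  ρ₁-ι₁ a rewrite πL-ι₁ a = refl

  ρ₂-ι₁ : ∀ a → ρ₂ (ι₁ a) ≡ u₂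
  ρ₂-ι₁ a rewrite πR-ι₁ a with ⌊ a ≟ u₁ ⌋
  ... | true  = refl
  ... | false = refl

  ρ₁-ι₂ : ∀ p → ρ₁ (ι₂ p) ≡ u₁
  ρ₁-ι₂ p with u₂ ≟ p
  ... | yes _    rewrite πL-ι₁ u₁ = refl
  ... | no  u₂≢p rewrite πL-↑ʳ (punchOut {i = u₂} u₂≢p) = refl

  ρ₂-ι₂ : ∀ p → ρ₂ (ι₂ p) ≡ p
  ρ₂-ι₂ p rewrite πR-ι₂ p = refl

  ι₁-injective : ∀ {a b} → ι₁ a ≡ ι₁ b → a ≡ b
  ι₁-injective {a} {b} eq = trans (sym (ρ₁-ι₁ a)) (trans (cong ρ₁ eq) (ρ₁-ι₁ b))

  ι₂-injective : ∀ {p q} → ι₂ p ≡ ι₂ q → p ≡ q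
  ι₂-injective {p} {q} eq = trans (sym (ρ₂-ι₂ p)) (trans (cong ρ₂ eq) (ρ₂-ι₂ q))

  ι₁≡ι₂ : ∀ {a p} → ι₁ a ≡ ι₂ p → p ≡ u₂
  ι₁≡ι₂ {a} {p} eq = trans (sym (ρ₂-ι₂ p)) (trans (cong ρ₂ (sym eq)) (ρ₂-ι₁ a))

  ι₁-hom : ∀ {a b} → T (G₁ a b) → T (G (ι₁ a) (ι₁ b))
  ι₁-hom {a} {b} e rewrite πL-ι₁ a | πL-ι₁ b = Equivalence.from T-∨ (inj₁ e)

  ι₂-hom : ∀ {p q} → T (G₂ p q) → T (G (ι₂ p) (ι₂ q))
  ι₂-hom {p} {q} e rewrite πR-ι₂ p | πR-ι₂ q =
    Equivalence.from (T-∨ {liftAdj G₁ (πL {n₁} {k₂} (ι₂ p)) (πL {n₁} {k₂} (ι₂ q))}) (inj₂ e)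

  private
    liftAdj-just : ∀ {m} (H : Graph m) mx my → T (liftAdj H mx my) →
                   Σ (Fin m) λ a → Σ (Fin m) λ b → mx ≡ just a × my ≡ just b × T (H a b)
    liftAdj-just H (just a) (just b) e = a , b , refl , refl , e

  edge-cases : ∀ {x y} → T (G x y) →
    (Σ (Fin n₁) λ a → Σ (Fin n₁) λ b → ι₁ a ≡ x × ι₁ b ≡ y × T (G₁ a b)) ⊎
    (Σ (Fin (suc k₂)) λ p → Σ (Fin (suc k₂)) λ q → ι₂ p ≡ x × ι₂ q ≡ y × T (G₂ p q))
  edge-cases {x} {y} e with Equivalence.to (T-∨ {liftAdj G₁ (πL {n₁} {k₂} x) (πL {n₁} {k₂} y)}) e
  ... | inj₁ e₁ = let a , b , x≡ , y≡ , e′ = liftAdj-just G₁ _ _ e₁ in inj₁ (a , b , πL-just x≡ , πL-just y≡ , e′)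
  ... | inj₂ e₂ = let p , q , x≡ , y≡ , e′ = liftAdj-just G₂ _ _ e₂ in inj₂ (p , q , πR-just x≡ , πR-just y≡ , e′)

  ρ-step : ∀ {x y} → T (G x y) →
           T (G₁ (ρ₁ x) (ρ₁ y)) × ρ₂ x ≡ ρ₂ y ⊎ ρ₁ x ≡ ρ₁ y × T (G₂ (ρ₂ x) (ρ₂ y))
  ρ-step e with edge-cases e
  ... | inj₁ (a , b , refl , refl , e₁) =
    inj₁ (subst₂ (λ a b → T (G₁ a b)) (sym (ρ₁-ι₁ a)) (sym (ρ₁-ι₁ b)) e₁ , trans (ρ₂-ι₁ a) (sym (ρ₂-ι₁ b)))
  ... | inj₂ (p , q , refl , refl , e₂) =
    inj₂ (trans (ρ₁-ι₂ p) (sym (ρ₁-ι₂ q)) , subst₂ (λ p q → T (G₂ p q)) (sym (ρ₂-ι₂ p)) (sym (ρ₂-ι₂ q)) e₂)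

  G-sym : (∀ a b → G₁ a b ≡ G₁ b a) → (∀ p q → G₂ p q ≡ G₂ q p) → ∀ x y → G x y ≡ G y x
  G-sym G₁-sym G₂-sym x y = cong₂ _∨_ (liftAdj-sym G₁-sym (πL {n₁} {k₂} x) (πL {n₁} {k₂} y))
                                      (liftAdj-sym G₂-sym (πR u₁ u₂ x) (πR u₁ u₂ y))
    where
    liftAdj-sym : ∀ {m} {H : Graph m} → (∀ a b → H a b ≡ H b a) → ∀ mx my → liftAdj H mx my ≡ liftAdj H my mx
    liftAdj-sym H-sym (just a) (just b) = H-sym a b
    liftAdj-sym H-sym (just _) nothing  = refl
    liftAdj-sym H-sym nothing  (just _) = refl
    liftAdj-sym H-sym nothing  nothing  = refl

  module _ (G₁-sym : ∀ a b → G₁ a b ≡ G₁ b a) (G₂-sym : ∀ p q → G₂ p q ≡ G₂ q p)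
           (G₁-connected : Connected G₁) (G₂-connected : Connected G₂) where

    private
      walk₁ : ∀ a b → Walk G₁ a b
      walk₁ = connected-walk G₁-connected

      walk₂ : ∀ p q → Walk G₂ p q
      walk₂ = connected-walk G₂-connected

      dist-ρ-≤ : ∀ {x y a b p q} → ρ₁ x ≡ a → ρ₁ y ≡ b → ρ₂ x ≡ p → ρ₂ y ≡ q →
                 Walk G x y → dist G₁ a b + dist G₂ p q ≤ dist G x y
      dist-ρ-≤ refl refl refl refl = dist-product-≤ ρ₁ ρ₂ ρ-step

    dist-ι₁ : ∀ a b → dist G (ι₁ a) (ι₁ b) ≡ dist G₁ a b
    dist-ι₁ a b = ≤-antisym (dist-hom-≤ G ι₁ ι₁-hom (walk₁ a b)) lower
      where
      lower : dist G₁ a b ≤ dist G (ι₁ a) (ι₁ b)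
      lower = ≤-trans (m≤m+n _ _)
        (dist-ρ-≤ (ρ₁-ι₁ a) (ρ₁-ι₁ b) (ρ₂-ι₁ a) (ρ₂-ι₁ b) (mapᵂ G ι₁ ι₁-hom (walk₁ a b)))

    dist-ι₂ : ∀ p q → dist G (ι₂ p) (ι₂ q) ≡ dist G₂ p q
    dist-ι₂ p q = ≤-antisym (dist-hom-≤ G ι₂ ι₂-hom (walk₂ p q)) lower
      where
      lower : dist G₂ p q ≤ dist G (ι₂ p) (ι₂ q)
      lower = ≤-trans (m≤n+m _ _)
        (dist-ρ-≤ (ρ₁-ι₂ p) (ρ₁-ι₂ q) (ρ₂-ι₂ p) (ρ₂-ι₂ q) (mapᵂ G ι₂ ι₂-hom (walk₂ p q)))

    dist-ι₁-ι₂ : ∀ a p → dist G (ι₁ a) (ι₂ p) ≡ dist G₁ a u₁ + dist G₂ u₂ p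
    dist-ι₁-ι₂ a p = ≤-antisym upper lower
      where
      v₁ : Σ (Walk G₁ a u₁) λ v → len v ≤ dist G₁ a u₁
      v₁ = geodesic (walk₁ a u₁)

      v₂ : Σ (Walk G₂ u₂ p) λ v → len v ≤ dist G₂ u₂ p
      v₂ = geodesic (walk₂ u₂ p)

      w₁ : Walk G (ι₁ a) u
      w₁ = mapᵂ G ι₁ ι₁-hom (proj₁ v₁)

      w₂ : Walk G u (ι₂ p)
      w₂ = castᵂ ι₂-u₂ refl (mapᵂ G ι₂ ι₂-hom (proj₁ v₂))

      upper : dist G (ι₁ a) (ι₂ p) ≤ dist G₁ a u₁ + dist G₂ u₂ p
      upper = begin
        dist G (ι₁ a) (ι₂ p)             ≤⟨ dist-≤ (w₁ ++ᵂ w₂) ⟩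
        len (w₁ ++ᵂ w₂)                  ≡⟨ len-++ᵂ w₁ w₂ ⟩
        len w₁ + len w₂                  ≡⟨ cong₂ _+_ (len-mapᵂ G ι₁ ι₁-hom (proj₁ v₁))
                                                      (trans (len-castᵂ ι₂-u₂ refl _) (len-mapᵂ G ι₂ ι₂-hom (proj₁ v₂))) ⟩
        len (proj₁ v₁) + len (proj₁ v₂)  ≤⟨ +-mono-≤ (proj₂ v₁) (proj₂ v₂) ⟩
        dist G₁ a u₁ + dist G₂ u₂ p      ∎
        where open ≤-Reasoning

      lower : dist G₁ a u₁ + dist G₂ u₂ p ≤ dist G (ι₁ a) (ι₂ p)
      lower = dist-ρ-≤ (ρ₁-ι₁ a) (ρ₁-ι₂ p) (ρ₂-ι₁ a) (ρ₂-ι₂ p) (w₁ ++ᵂ w₂)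

    -- every walk from the G₁ side to the G₂ side passes through u
    dist-through-u : ∀ a p → dist G (ι₁ a) (ι₂ p) ≡ dist G (ι₁ a) u + dist G (ι₂ p) u
    dist-through-u a p = trans (dist-ι₁-ι₂ a p) (cong₂ _+_ (sym (dist-ι₁ a u₁)) (begin
      dist G₂ u₂ p          ≡⟨ dist-sym G₂-sym u₂ p ⟩
      dist G₂ p u₂          ≡⟨ dist-ι₂ p u₂ ⟨
      dist G (ι₂ p) (ι₂ u₂) ≡⟨ cong (dist G (ι₂ p)) ι₂-u₂ ⟩
      dist G (ι₂ p) u       ∎))
      where open ≡-Reasoning

    E₁ᴳ : List (Edge (n₁ + k₂))
    E₁ᴳ = map (mapEdge ι₁) (edges G₁)

    -- ι₂ sends u₂ into the G₁ block, so it may reverse the order of the endpoints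
    E₂ᴳ : List (Edge (n₁ + k₂))
    E₂ᴳ = map (orient ∘ mapEdge ι₂) (edges G₂)

    ι₂-edge-cancel : ∀ {e f} → Ordered e → Ordered f → orient (mapEdge ι₂ e) ≡ orient (mapEdge ι₂ f) → e ≡ f
    ι₂-edge-cancel {p , q} {r , s} p<q r<s eq with orient-cancel (ι₂ p , ι₂ q) (ι₂ r , ι₂ s) eq
    ... | inj₁ eq′ = cong₂ _,_ (ι₂-injective (cong proj₁ eq′)) (ι₂-injective (cong proj₂ eq′))
    ... | inj₂ eq′ with ι₂-injective (cong proj₁ eq′) | ι₂-injective (cong proj₂ eq′)
    ...   | refl | refl = ⊥-elim (Fin.<-asym p<q r<s)

    -- an edge of G₁ and an edge of G₂ share at most the vertex u
    ι₁-ι₂-edge-distinct : ∀ {e f} → Ordered f → mapEdge ι₁ e ≢ orient (mapEdge ι₂ f)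
    ι₁-ι₂-edge-distinct {a , b} {p , q} p<q eq with orient-cases (ι₂ p , ι₂ q)
    ... | inj₁ o≡ = Fin.<⇒≢ p<q (trans (ι₁≡ι₂ (cong proj₁ (trans eq o≡))) (sym (ι₁≡ι₂ (cong proj₂ (trans eq o≡)))))
    ... | inj₂ o≡ = Fin.<⇒≢ p<q (trans (ι₁≡ι₂ (cong proj₂ (trans eq o≡))) (sym (ι₁≡ι₂ (cong proj₁ (trans eq o≡)))))

    edgeDist-ι₁ : ∀ e f → edgeDist G (mapEdge ι₁ e) (mapEdge ι₁ f) ≡ edgeDist G₁ e f
    edgeDist-ι₁ = edgeDist-map ι₁ ι₁-injective dist-ι₁

    edgeDist-ι₂ : ∀ {e f} → Ordered e → Ordered f →
                  edgeDist G (orient (mapEdge ι₂ e)) (orient (mapEdge ι₂ f)) ≡ edgeDist G₂ e f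
    edgeDist-ι₂ {e} {f} oe of =
      trans (edgeDist-orient G (mapEdge ι₂ e) (mapEdge ι₂ f) (cong (mapEdge ι₂) ∘ ι₂-edge-cancel oe of))
            (edgeDist-map ι₂ ι₂-injective dist-ι₂ e f)

    edgeDist-ι₁-ι₂ : ∀ e {f} → Ordered f →
      edgeDist G (mapEdge ι₁ e) (orient (mapEdge ι₂ f))
        ≡ suc (edgeVertexDist G (mapEdge ι₁ e) u + edgeVertexDist G (mapEdge ι₂ f) u)
    edgeDist-ι₁-ι₂ (a , b) {p , q} p<q = begin
      edgeDist G (ι₁ a , ι₁ b) (orient (ι₂ p , ι₂ q))
        ≡⟨ edgeDist-≢ G _ _ (ι₁-ι₂-edge-distinct p<q) ⟩
      suc (endpointDist G (ι₁ a , ι₁ b) (orient (ι₂ p , ι₂ q)))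
        ≡⟨ cong suc (endpointDist-orientʳ G _ _) ⟩
      suc (min4 (dist G (ι₁ a) (ι₂ p)) (dist G (ι₁ a) (ι₂ q)) (dist G (ι₁ b) (ι₂ p)) (dist G (ι₁ b) (ι₂ q)))
        ≡⟨ cong suc (cong₂ _⊓_ (cong₂ _⊓_ (dist-through-u a p) (dist-through-u a q))
                               (cong₂ _⊓_ (dist-through-u b p) (dist-through-u b q))) ⟩
      suc (min4 (dist G (ι₁ a) u + dist G (ι₂ p) u) (dist G (ι₁ a) u + dist G (ι₂ q) u)
                (dist G (ι₁ b) u + dist G (ι₂ p) u) (dist G (ι₁ b) u + dist G (ι₂ q) u))
        ≡⟨ cong suc (min4-+ (dist G (ι₁ a) u) (dist G (ι₁ b) u) (dist G (ι₂ p) u) (dist G (ι₂ q) u)) ⟩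
      suc (edgeVertexDist G (ι₁ a , ι₁ b) u + edgeVertexDist G (ι₂ p , ι₂ q) u) ∎
      where open ≡-Reasoning

    private
      ι₁-<-mono : ∀ {a b} → a <ᶠ b → ι₁ a <ᶠ ι₁ b
      ι₁-<-mono {a} {b} = subst₂ ℕ._<_ (sym (Fin.toℕ-↑ˡ a k₂)) (sym (Fin.toℕ-↑ˡ b k₂))

      ι₁-<-reflect : ∀ {a b} → ι₁ a <ᶠ ι₁ b → a <ᶠ b
      ι₁-<-reflect {a} {b} = subst₂ ℕ._<_ (Fin.toℕ-↑ˡ a k₂) (Fin.toℕ-↑ˡ b k₂)

      ι₂-≢ : ∀ {p q} → p <ᶠ q → ι₂ p ≢ ι₂ q
      ι₂-≢ p<q = Fin.<⇒≢ p<q ∘ ι₂-injective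

      edges-⊆ : ∀ {z} → z ∈ edges G → z ∈ E₁ᴳ ++ E₂ᴳ
      edges-⊆ {i , j} z∈ with ∈-edges⁻ G z∈
      ... | i<j , Gij with edge-cases Gij
      ... | inj₁ (a , b , refl , refl , e₁) =
        ∈-++⁺ˡ (∈-map⁺ (mapEdge ι₁) (∈-edges⁺ G₁ (ι₁-<-reflect i<j) e₁))
      ... | inj₂ (p , q , refl , refl , e₂) with Fin.<-cmp p q
      ...   | tri< p<q _ _ = ∈-++⁺ʳ E₁ᴳ (subst (_∈ E₂ᴳ) (orient-< i<j) (∈-map⁺ _ (∈-edges⁺ G₂ p<q e₂)))
      ...   | tri≈ _ refl _ = ⊥-elim (Fin.<-irrefl refl i<j)
      ...   | tri> _ _ q<p = ∈-++⁺ʳ E₁ᴳ (subst (_∈ E₂ᴳ) (trans (orient-swap (ι₂-≢ q<p ∘ sym)) (orient-< i<j))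
                                         (∈-map⁺ _ (∈-edges⁺ G₂ q<p (subst T (G₂-sym p q) e₂))))

      edges-⊇ : ∀ {z} → z ∈ E₁ᴳ ++ E₂ᴳ → z ∈ edges G
      edges-⊇ z∈ with ∈-++⁻ E₁ᴳ z∈
      ... | inj₁ z∈₁ with ∈-map⁻ (mapEdge ι₁) z∈₁
      ...   | (a , b) , e∈ , refl = let a<b , e₁ = ∈-edges⁻ G₁ e∈ in ∈-edges⁺ G (ι₁-<-mono a<b) (ι₁-hom e₁)
      edges-⊇ z∈ | inj₂ z∈₂ with ∈-map⁻ (orient ∘ mapEdge ι₂) z∈₂
      ...   | (p , q) , e∈ , refl with ∈-edges⁻ G₂ e∈
      ...   | p<q , e₂ with orient-cases (ι₂ p , ι₂ q)
      ...   | inj₁ o≡ = subst (_∈ edges G) (sym o≡)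
                          (∈-edges⁺ G (subst Ordered o≡ (orient-ordered (ι₂-≢ p<q))) (ι₂-hom e₂))
      ...   | inj₂ o≡ = subst (_∈ edges G) (sym o≡)
                          (∈-edges⁺ G (subst Ordered o≡ (orient-ordered (ι₂-≢ p<q)))
                                      (subst T (G-sym G₁-sym G₂-sym (ι₂ p) (ι₂ q)) (ι₂-hom e₂)))

      E₁ᴳ++E₂ᴳ-unique : Unique (E₁ᴳ ++ E₂ᴳ)
      E₁ᴳ++E₂ᴳ-unique = Unique.++⁺
        (Unique.map⁺ (λ eq → cong₂ _,_ (ι₁-injective (cong proj₁ eq)) (ι₁-injective (cong proj₂ eq))) (edges-unique G₁))
        (Unique-map⁺-All ι₂-edge-cancel (edges-ordered G₂) (edges-unique G₂))
        λ (z∈₁ , z∈₂) → disjoint (∈-map⁻ (mapEdge ι₁) z∈₁) (∈-map⁻ (orient ∘ mapEdge ι₂) z∈₂)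
        where
        disjoint : ∀ {z} → (Σ (Edge n₁) λ e → e ∈ edges G₁ × z ≡ mapEdge ι₁ e) →
                   (Σ (Edge (suc k₂)) λ f → f ∈ edges G₂ × z ≡ orient (mapEdge ι₂ f)) → ⊥
        disjoint (e , _ , refl) (f , f∈ , eq) = ι₁-ι₂-edge-distinct (All.lookup (edges-ordered G₂) f∈) eq

    edges-coalesce-↭ : edges G ↭ E₁ᴳ ++ E₂ᴳ
    edges-coalesce-↭ = unique-↭ (edges-unique G) E₁ᴳ++E₂ᴳ-unique edges-⊆ edges-⊇

    We-coalesce : We G ≡ We G₁ + We G₂
      + length (edges G₁) * sum (map (λ f → edgeVertexDist G (mapEdge ι₂ f) u) (edges G₂))
      + length (edges G₂) * sum (map (λ e → edgeVertexDist G (mapEdge ι₁ e) u) (edges G₁))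
      + length (edges G₁) * length (edges G₂)
    We-coalesce = begin
      We G
        ≡⟨ pairSum-↭ (edgeDist G) (edgeDist-sym (G-sym G₁-sym G₂-sym)) edges-coalesce-↭ ⟩
      pairSum (edgeDist G) (E₁ᴳ ++ E₂ᴳ)
        ≡⟨ pairSum-++ (edgeDist G) E₁ᴳ E₂ᴳ ⟩
      pairSum (edgeDist G) E₁ᴳ + pairSum (edgeDist G) E₂ᴳ + sum (map (λ x → sum (map (edgeDist G x) E₂ᴳ)) E₁ᴳ)
        ≡⟨ cong₂ _+_ (cong₂ _+_ within₁ within₂) across ⟩
      We G₁ + We G₂ + (m₂ * (m₁ + Σd₁) + m₁ * Σd₂)
        ≡⟨ solve 6 (λ w₁ w₂ m₁ m₂ a b → w₁ :+ w₂ :+ (m₂ :* (m₁ :+ a) :+ m₁ :* b)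
                                       := w₁ :+ w₂ :+ m₁ :* b :+ m₂ :* a :+ m₁ :* m₂)
                   refl (We G₁) (We G₂) m₁ m₂ Σd₁ Σd₂ ⟩
      We G₁ + We G₂ + m₁ * Σd₂ + m₂ * Σd₁ + m₁ * m₂ ∎
      where
      open ≡-Reasoning; open +-*-Solver
      d₁ : Edge n₁ → ℕ
      d₁ e = edgeVertexDist G (mapEdge ι₁ e) u
      d₂ : Edge (suc k₂) → ℕ
      d₂ f = edgeVertexDist G (mapEdge ι₂ f) u
      m₁ m₂ Σd₁ Σd₂ : ℕ
      m₁ = length (edges G₁)
      m₂ = length (edges G₂)
      Σd₁ = sum (map d₁ (edges G₁))
      Σd₂ = sum (map d₂ (edges G₂))

      within₁ : pairSum (edgeDist G) E₁ᴳ ≡ We G₁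
      within₁ = trans (pairSum-map (edgeDist G) (mapEdge ι₁) (edges G₁))
                      (pairSum-cong-All (λ {e} {f} _ _ → edgeDist-ι₁ e f) (edges-ordered G₁))

      within₂ : pairSum (edgeDist G) E₂ᴳ ≡ We G₂
      within₂ = trans (pairSum-map (edgeDist G) (orient ∘ mapEdge ι₂) (edges G₂))
                      (pairSum-cong-All edgeDist-ι₂ (edges-ordered G₂))

      across : sum (map (λ x → sum (map (edgeDist G x) E₂ᴳ)) E₁ᴳ) ≡ m₂ * (m₁ + Σd₁) + m₁ * Σd₂
      across = begin
        sum (map (λ x → sum (map (edgeDist G x) E₂ᴳ)) E₁ᴳ)
          ≡⟨ sum-map-∘ (λ x → sum (map (edgeDist G x) E₂ᴳ)) (mapEdge ι₁) (edges G₁) ⟩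
        sum (map (λ e → sum (map (edgeDist G (mapEdge ι₁ e)) E₂ᴳ)) (edges G₁))
          ≡⟨ sum-map-cong {xs = edges G₁} (All.tabulate λ {e} _ →
               trans (sum-map-∘ (edgeDist G (mapEdge ι₁ e)) (orient ∘ mapEdge ι₂) (edges G₂))
                     (sum-map-cong (All.map (edgeDist-ι₁-ι₂ e) (edges-ordered G₂)))) ⟩
        sum (map (λ e → sum (map (λ f → suc (d₁ e) + d₂ f) (edges G₂))) (edges G₁))
          ≡⟨ sum-map-sum-map-+ (suc ∘ d₁) d₂ (edges G₁) (edges G₂) ⟩
        m₂ * sum (map (suc ∘ d₁) (edges G₁)) + m₁ * Σd₂
          ≡⟨ cong (λ s → m₂ * s + m₁ * Σd₂) (sum-map-suc d₁ (edges G₁)) ⟩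
        m₂ * (m₁ + Σd₁) + m₁ * Σd₂ ∎

lemma2 : ∀ {n1 k2} (G1 : Graph n1) (G2 : Graph (suc k2)) (u1 : Fin n1) (u2 : Fin (suc k2)) →
    IsSimple G1 → IsSimple G2 → Connected G1 → Connected G2 →
    2 ≤ n1 → 2 ≤ suc k2 → 1 ≤ numEdges G1 → 1 ≤ numEdges G2 →
    We (coalesce G1 G2 u1 u2)
      ≡ We G1 + We G2
        + numEdges G1 * sum (map (λ f → edgeVertexDist (coalesce G1 G2 u1 u2) (mapEdge (ι2 u1 u2) f) (newVertex k2 u1)) (edges G2))
        + numEdges G2 * sum (map (λ g → edgeVertexDist (coalesce G1 G2 u1 u2) (mapEdge (ι1 k2) g) (newVertex k2 u1)) (edges G1))
        + numEdges G1 * numEdges G2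
lemma2 G1 G2 u1 u2 (G1-sym , _) (G2-sym , _) G1-connected G2-connected _ _ _ _ =
  Coalescence.We-coalesce G1 G2 u1 u2 G1-sym G2-sym G1-connected G2-connected
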